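{- Let $f(x)=ax^2+bx+c$ be an irreducible quadratic polynomial in $\mathbb{Z}[x]$ with $a>0$ such that $f(x)$ is positive and increasing for real $x\ge1$, and let $D=b^2-4ac$. For a prime $p$ and $n\ge 2$ let $\alpha_p(n)$ be the exponent of $p$ in $\prod_{i=1}^n f(i)$. Then for every prime $p\nmid 2aD$, $$\alpha_p(n)=n\,\frac{1+(D/p)}{p-1}+O\Bigl(\frac{\log n}{\log p}\Bigr),$$ with implied constant depending only on $f$.
   Context: $(D/p)$ is the Legendre symbol. -}

module Defs where

open import Data.Nat as ℕ using (ℕ; zero; suc)
import Data.Nat.Divisibility as ℕD
open import Data.Integer as ℤ using (ℤ; +_; ∣_∣)
open import Data.Rational as ℚ using (ℚ; _/_)
open import Data.List using (List; upTo)
open import Data.Bool.ListAction using (any)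
open import Data.Bool using (Bool; if_then_else_)
open import Data.Product using (_×_)
open import Data.Empty using (⊥)
open import Relation.Nullary.Decidable using (⌊_⌋; does)
open import Relation.Binary.PropositionalEquality using (_≡_)

disc : ℤ → ℤ → ℤ → ℤ
disc a b c = b ℤ.* b ℤ.- + 4 ℤ.* a ℤ.* c

fZ : ℤ → ℤ → ℤ → ℕ → ℤ
fZ a b c i = a ℤ.* + i ℤ.* + i ℤ.+ b ℤ.* + i ℤ.+ c

prodF : ℤ → ℤ → ℤ → ℕ → ℤ
prodF a b c zero    = ℤ.1ℤ
prodF a b c (suc n) = prodF a b c n ℤ.* fZ a b c (suc n)

fQ : ℤ → ℤ → ℤ → ℚ → ℚ
fQ a b c x = (a / 1) ℚ.* x ℚ.* x ℚ.+ (b / 1) ℚ.* x ℚ.+ (c / 1)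

-- For degree 2 the only factorisations are
-- (constant d)·(quadratic) and (linear)·(linear); linear factors are never units.
Irreducible : ℤ → ℤ → ℤ → Set
Irreducible a b c =
  (∀ d a′ b′ c′ → a ≡ d ℤ.* a′ → b ≡ d ℤ.* b′ → c ≡ d ℤ.* c′ → ∣ d ∣ ≡ 1)
  × (∀ p q r s → a ≡ p ℤ.* r → b ≡ p ℤ.* s ℤ.+ q ℤ.* r → c ≡ q ℤ.* s → ⊥)

-- f positive and (strictly) increasing for x ≥ 1 (tested on rational x; equivalent
-- to the real statement by continuity/density)
PosIncr : ℤ → ℤ → ℤ → Set
PosIncr a b c =
  (∀ x → ℚ.1ℚ ℚ.≤ x → ℚ.0ℚ ℚ.< fQ a b c x)
  × (∀ x y → ℚ.1ℚ ℚ.≤ x → x ℚ.< y → fQ a b c x ℚ.< fQ a b c y)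

isSquareMod : ℤ → ℕ → Bool
isSquareMod D p = any (λ x → does (p ℕD.∣? ∣ + x ℤ.* + x ℤ.- D ∣)) (upTo p)

legendre : ℤ → ℕ → ℤ
legendre D p =
  if does (p ℕD.∣? ∣ D ∣) then ℤ.0ℤ
  else (if isSquareMod D p then ℤ.1ℤ else ℤ.-1ℤ)

IsExponent : ℕ → ℕ → ℕ → Set
IsExponent p m k = (p ℕ.^ k ℕD.∣ m) × (Relation.Nullary.¬ (p ℕ.^ suc k ℕD.∣ m))
  where import Relation.Nullary

-- Write N_j(n) for the number of i ≤ n with pʲ ∣ f(i), so that α_p(n) = Σ_{j ≥ 1} N_j(n).
-- Since 4a f(i) = (2ai + b)² − D and p ∤ 2aD, Hensel lifting shows that the i with pʲ ∣ f(i)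
-- fill exactly ρ = 1 + (D/p) residue classes mod pʲ, hence ρ ⌊n/pʲ⌋ ≤ N_j(n) ≤ ρ ⌊n/pʲ⌋ + 2;
-- and N_j(n) = 0 as soon as pʲ exceeds B = (|a| + |b| + |c|) n² ≥ |f(i)|. Summing over j and
-- using Legendre's formula (p − 1) Σ_j ⌊n/pʲ⌋ = n − s_p(n), the deviation (p − 1) α_p(n) − ρ n
-- equals (p − 1) E − ρ s_p(n), where p^E ≤ B² and p^(s_p(n)) ≤ n^(2(p − 1)); both terms are
-- therefore at most C (p − 1) log n / log p with C depending only on f.
module Submission where

open import Defs

open import Data.Bool using (true; false; if_then_else_; T)
open import Data.Empty using (⊥; ⊥-elim)
open import Data.Integer as ℤ using (ℤ; +_; ∣_∣; 0ℤ; 1ℤ)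
open import Data.Integer.DivMod using (_%ℕ_; _/ℕ_; a≡a%ℕn+[a/ℕn]*n; n%ℕd<d)
import Data.Integer.Divisibility.Signed as ℤD
import Data.Integer.Properties as ℤP
open import Data.Integer.Tactic.RingSolver using () renaming (solve-∀ to ℤ-solve)
open import Data.List using (upTo)
open import Data.List.Membership.Propositional using (lose)
open import Data.List.Membership.Propositional.Properties using (∈-upTo⁺)
open import Data.List.Relation.Unary.Any using (satisfied)
open import Data.List.Relation.Unary.Any.Properties using (any⁺; any⁻)
open import Data.Nat as ℕ
  using (ℕ; zero; suc; _+_; _*_; _∸_; _^_; _≤_; _<_; _⊓_; _/_; _%_; z≤n; s≤s;
         NonZero; >-nonZero; ≢-nonZero; nonTrivial⇒n>1)
open import Data.Nat.Coprimality using (Coprime; coprime-factors; coprime-divisor; coprime-Bézout)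
open import Data.Nat.Divisibility
open import Data.Nat.DivMod
open import Data.Nat.GCD using (module Bézout)
open import Data.Nat.Primality
  using (Prime; euclidsLemma; prime⇒nonZero; prime⇒irreducible; prime⇒nonTrivial; ¬prime[0]; ¬prime[1])
open import Data.Nat.Properties
open import Data.Nat.Tactic.RingSolver using () renaming (solve-∀ to ℕ-solve)
open import Data.Product using (_×_; _,_; _,′_; proj₁; proj₂; ∃-syntax)
open import Data.Sum using (_⊎_; inj₁; inj₂; [_,_])
open import Data.Sum.Function.Propositional using (_⊎-⇔_)
open import Function.Base using (_∘_; case_of_)
open import Function.Bundles using (_⇔_; mk⇔; Equivalence)
open import Function.Construct.Composition using (_⇔-∘_)
open import Relation.Binary.Definitions using (tri<; tri≈; tri>)
open import Relation.Binary.PropositionalEquality hiding ([_])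
open import Relation.Nullary using (¬_; Dec; yes; no; does)

^-distribʳ-* : ∀ m n o → (m * n) ^ o ≡ m ^ o * n ^ o
^-distribʳ-* m n zero    = refl
^-distribʳ-* m n (suc o) = begin
  m * n * (m * n) ^ o     ≡⟨ cong (m * n *_) (^-distribʳ-* m n o) ⟩
  m * n * (m ^ o * n ^ o) ≡⟨ interchange m n (m ^ o) (n ^ o) ⟩
  m ^ suc o * n ^ suc o   ∎
  where
  open ≡-Reasoning
  interchange : ∀ a b c d → a * b * (c * d) ≡ a * c * (b * d)
  interchange = ℕ-solve

n<m^n : ∀ {m} → 1 < m → ∀ n → n < m ^ n
n<m^n 1<m zero    = s≤s z≤n
n<m^n {m} 1<m (suc n) = begin-strict
  suc n           ≤⟨ n<m^n 1<m n ⟩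
  m ^ n           <⟨ m<m+n (m ^ n) (≤-trans (s≤s z≤n) (n<m^n 1<m n)) ⟩
  m ^ n + m ^ n   ≡⟨ cong (_+_ (m ^ n)) (sym (+-identityʳ (m ^ n))) ⟩
  2 * m ^ n       ≤⟨ *-monoˡ-≤ (m ^ n) 1<m ⟩
  m ^ suc n       ∎
  where open ≤-Reasoning

-- Write m − 1 = q n + r with r < n; then m ≤ (q + 1) n ≤ n ^ (2q) and q n ≤ m − 1.
m^n≤n^[2*[m∸1]] : ∀ {m n} → 2 ≤ n → n < m → m ^ n ≤ n ^ (2 * (m ∸ 1))
m^n≤n^[2*[m∸1]] {suc t} {n} 2≤n (s≤s n≤t) = begin
  suc t ^ n          ≤⟨ ^-monoˡ-≤ n suc-t≤[1+q]*n ⟩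
  (suc q * n) ^ n    ≤⟨ ^-monoˡ-≤ n [1+q]*n≤n^[2q] ⟩
  (n ^ (2 * q)) ^ n  ≡⟨ ^-*-assoc n (2 * q) n ⟩
  n ^ (2 * q * n)    ≤⟨ ^-monoʳ-≤ n (≤-trans (≤-reflexive (*-assoc 2 q n)) (*-monoʳ-≤ 2 (m/n*n≤m t n))) ⟩
  n ^ (2 * t)        ∎
  where
  open ≤-Reasoning
  instance
    _ : NonZero n
    _ = >-nonZero (≤-trans (s≤s z≤n) 2≤n)
  q = t / n
  suc-t≤[1+q]*n : suc t ≤ suc q * n
  suc-t≤[1+q]*n = begin
    suc t               ≡⟨ cong suc (m≡m%n+[m/n]*n t n) ⟩
    suc (t % n + q * n) ≤⟨ +-monoˡ-≤ (q * n) (m%n<n t n) ⟩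
    n + q * n           ∎
  1≤q : 1 ≤ q
  1≤q = ≤-trans (≤-reflexive (sym (n/n≡1 n))) (/-monoˡ-≤ n n≤t)
  [1+q]*n≤n^[2q] : suc q * n ≤ n ^ (2 * q)
  [1+q]*n≤n^[2q] = begin
    suc q * n          ≤⟨ *-mono-≤ (n<m^n (s≤s (s≤s z≤n)) q) (≤-trans (≤-reflexive (sym (*-identityʳ n))) (^-monoʳ-≤ n 1≤q)) ⟩
    2 ^ q * n ^ q      ≤⟨ *-monoˡ-≤ (n ^ q) (^-monoˡ-≤ q 2≤n) ⟩
    n ^ q * n ^ q      ≡⟨ sym (^-distribˡ-+-* n q q) ⟩
    n ^ (q + q)        ≡⟨ cong (λ e → n ^ (q + e)) (sym (+-identityʳ q)) ⟩
    n ^ (2 * q)        ∎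

^-monoʳ-∣ : ∀ p {i j} → i ≤ j → p ^ i ∣ p ^ j
^-monoʳ-∣ p {i} {j} i≤j = divides (p ^ (j ∸ i)) (begin
  p ^ j             ≡⟨ cong (p ^_) (sym (m∸n+n≡m i≤j)) ⟩
  p ^ (j ∸ i + i)   ≡⟨ ^-distribˡ-+-* p (j ∸ i) i ⟩
  p ^ (j ∸ i) * p ^ i ∎)
  where open ≡-Reasoning

p^∣x⊖y∣≤ : ∀ p .{{_ : NonZero p}} {x y X} → p ^ x ≤ X → p ^ y ≤ X → p ^ ∣ x ℤ.⊖ y ∣ ≤ X
p^∣x⊖y∣≤ p {x} {y} p^x≤X p^y≤X with ⊔-sel x y
... | inj₁ x⊔y≡x = ≤-trans (^-monoʳ-≤ p (subst (∣ x ℤ.⊖ y ∣ ≤_) x⊔y≡x (ℤP.∣m⊝n∣≤m⊔n x y))) p^x≤X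
... | inj₂ x⊔y≡y = ≤-trans (^-monoʳ-≤ p (subst (∣ x ℤ.⊖ y ∣ ≤_) x⊔y≡y (ℤP.∣m⊝n∣≤m⊔n x y))) p^y≤X

-- ∑[ i ≤ n ] g i = g 1 + ⋯ + g n: the index starts at 1.
∑ : ℕ → (ℕ → ℕ) → ℕ
∑ zero    g = 0
∑ (suc n) g = ∑ n g + g (suc n)

syntax ∑ n (λ i → e) = ∑[ i ≤ n ] e

module _ {g h : ℕ → ℕ} where

  ∑-cong : ∀ n → (∀ {i} → 1 ≤ i → i ≤ n → g i ≡ h i) → ∑ n g ≡ ∑ n h
  ∑-cong zero    eq = refl
  ∑-cong (suc n) eq = cong₂ _+_ (∑-cong n (λ 1≤i i≤n → eq 1≤i (m≤n⇒m≤1+n i≤n))) (eq (s≤s z≤n) ≤-refl)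

  ∑-distrib-+ : ∀ n → ∑[ i ≤ n ] (g i + h i) ≡ ∑ n g + ∑ n h
  ∑-distrib-+ zero    = refl
  ∑-distrib-+ (suc n) = trans (cong (_+ (g (suc n) + h (suc n))) (∑-distrib-+ n))
                              (interchange (∑ n g) (∑ n h) (g (suc n)) (h (suc n)))
    where
    interchange : ∀ a b c d → a + b + (c + d) ≡ a + c + (b + d)
    interchange = ℕ-solve

∑-distribˡ-* : ∀ c {g} n → ∑[ i ≤ n ] (c * g i) ≡ c * ∑ n g
∑-distribˡ-* c zero    = sym (*-zeroʳ c)
∑-distribˡ-* c {g} (suc n) = trans (cong (_+ c * g (suc n)) (∑-distribˡ-* c n)) (sym (*-distribˡ-+ c (∑ n g) (g (suc n))))

∑-zero : ∀ {g} n → (∀ {i} → 1 ≤ i → i ≤ n → g i ≡ 0) → ∑ n g ≡ 0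
∑-zero zero    g≡0 = refl
∑-zero (suc n) g≡0 = cong₂ _+_ (∑-zero n (λ 1≤i i≤n → g≡0 1≤i (m≤n⇒m≤1+n i≤n))) (g≡0 (s≤s z≤n) ≤-refl)

∑-shift : ∀ g n → ∑ (suc n) g ≡ g 1 + ∑[ i ≤ n ] g (suc i)
∑-shift g zero    = +-comm 0 (g 1)
∑-shift g (suc n) = trans (cong (_+ g (suc (suc n))) (∑-shift g n)) (+-assoc (g 1) _ _)

χ : ∀ {A : Set} → Dec A → ℕ
χ (yes _) = 1
χ (no _)  = 0

χ-yes : ∀ {A : Set} (d : Dec A) → A → χ d ≡ 1
χ-yes (yes _) a = refl
χ-yes (no ¬a) a = ⊥-elim (¬a a)

χ-no : ∀ {A : Set} (d : Dec A) → ¬ A → χ d ≡ 0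
χ-no (yes a) ¬a = ⊥-elim (¬a a)
χ-no (no _)  ¬a = refl

χ-⊎ : ∀ {P Q R : Set} (P? : Dec P) (Q? : Dec Q) (R? : Dec R) →
      P ⇔ (Q ⊎ R) → (Q → R → ⊥) → χ P? ≡ χ Q? + χ R?
χ-⊎ P? (yes q) (yes r) P⇔Q⊎R Q∧R⇒⊥ = ⊥-elim (Q∧R⇒⊥ q r)
χ-⊎ P? (yes q) (no ¬r) P⇔Q⊎R Q∧R⇒⊥ = χ-yes P? (Equivalence.from P⇔Q⊎R (inj₁ q))
χ-⊎ P? (no ¬q) (yes r) P⇔Q⊎R Q∧R⇒⊥ = χ-yes P? (Equivalence.from P⇔Q⊎R (inj₂ r))
χ-⊎ P? (no ¬q) (no ¬r) P⇔Q⊎R Q∧R⇒⊥ = χ-no P? λ p → [ ¬q , ¬r ] (Equivalence.to P⇔Q⊎R p)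

-- Counting the multiples of m in a shifted interval

module _ (m : ℕ) .{{_ : NonZero m}} where

  -- Write x = r + q m with r < m; m divides x + 1 exactly when r + 1 = m.
  [1+x]/m≡x/m+χ : ∀ x → suc x / m ≡ x / m + χ (m ∣? suc x)
  [1+x]/m≡x/m+χ x with m≤n⇒m<n∨m≡n (m%n<n x m)
  ... | inj₁ 1+r<m = begin
    suc x / m             ≡⟨ /-congˡ (cong suc x≡r+q*m) ⟩
    (suc r + q * m) / m   ≡⟨ +-distrib-/-∣ʳ (suc r) (n∣m*n q) ⟩
    suc r / m + q * m / m ≡⟨ cong₂ _+_ (m<n⇒m/n≡0 1+r<m) (m*n/n≡m q m) ⟩
    q                     ≡⟨ sym (+-identityʳ q) ⟩
    q + 0                 ≡⟨ cong (_+_ q) (sym (χ-no (m ∣? suc x) m∤1+x)) ⟩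
    q + χ (m ∣? suc x)    ∎
    where
    open ≡-Reasoning
    r = x % m
    q = x / m
    x≡r+q*m = m≡m%n+[m/n]*n x m
    m∤1+x : ¬ m ∣ suc x
    m∤1+x m∣1+x = 0≢1+n (begin
      0                     ≡⟨ sym (n∣m⇒m%n≡0 (suc x) m m∣1+x) ⟩
      suc x % m             ≡⟨ %-congˡ (cong suc x≡r+q*m) ⟩
      (suc r + q * m) % m   ≡⟨ [m+kn]%n≡m%n (suc r) q m ⟩
      suc r % m             ≡⟨ m<n⇒m%n≡m 1+r<m ⟩
      suc r                 ∎)
  ... | inj₂ 1+r≡m = begin
    suc x / m             ≡⟨ /-congˡ 1+x≡[1+q]*m ⟩
    suc q * m / m         ≡⟨ m*n/n≡m (suc q) m ⟩
    suc q                 ≡⟨ +-comm 1 q ⟩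
    q + 1                 ≡⟨ cong (_+_ q) (sym (χ-yes (m ∣? suc x) (divides (suc q) 1+x≡[1+q]*m))) ⟩
    q + χ (m ∣? suc x)    ∎
    where
    open ≡-Reasoning
    q = x / m
    1+x≡[1+q]*m : suc x ≡ suc q * m
    1+x≡[1+q]*m = trans (cong suc (m≡m%n+[m/n]*n x m)) (cong (_+ q * m) 1+r≡m)

  ∑χ[m∣i+t]≡[n+t]/m : ∀ {t} → t < m → ∀ n → ∑[ i ≤ n ] χ (m ∣? i + t) ≡ (n + t) / m
  ∑χ[m∣i+t]≡[n+t]/m t<m zero    = sym (m<n⇒m/n≡0 t<m)
  ∑χ[m∣i+t]≡[n+t]/m {t} t<m (suc n) =
    trans (cong (_+ χ (m ∣? suc (n + t))) (∑χ[m∣i+t]≡[n+t]/m t<m n)) (sym ([1+x]/m≡x/m+χ (n + t)))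

  [n+t]/m≤n/m+1 : ∀ {t} → t < m → ∀ n → (n + t) / m ≤ n / m + 1
  [n+t]/m≤n/m+1 {t} t<m n = begin
    (n + t) / m     ≤⟨ /-monoˡ-≤ m (+-monoʳ-≤ n (<⇒≤ t<m)) ⟩
    (n + m) / m     ≡⟨ +-distrib-/-∣ʳ n ∣-refl ⟩
    n / m + m / m   ≡⟨ cong (_+_ (n / m)) (n/n≡1 m) ⟩
    n / m + 1       ∎
    where open ≤-Reasoning

  two-residues-bounds : ∀ {t₁ t₂} → t₁ < m → t₂ < m → ∀ n →
    2 * (n / m) ≤ (n + t₁) / m + (n + t₂) / m × (n + t₁) / m + (n + t₂) / m ≤ 2 * (n / m) + 2
  two-residues-bounds {t₁} {t₂} t₁<m t₂<m n =
    +-mono-≤ (/-monoˡ-≤ m (m≤m+n n t₁)) (≤-trans (≤-reflexive (+-identityʳ (n / m))) (/-monoˡ-≤ m (m≤m+n n t₂))) ,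
    ≤-trans (+-mono-≤ ([n+t]/m≤n/m+1 t₁<m n) ([n+t]/m≤n/m+1 t₂<m n)) (≤-reflexive (regroup (n / m)))
    where
    regroup : ∀ q → q + 1 + (q + 1) ≡ 2 * q + 2
    regroup = ℕ-solve

-- Legendre's formula

-- Invariant: p^(d₁ + ⋯ + d_L) ≤ min(p^L, B)².
p^∑≤B*B : ∀ {p} .{{_ : NonZero p}} {B} d → 1 ≤ B → (∀ j → d (suc j) ≤ 2) →
          (∀ j → B < p ^ suc j → d (suc j) ≡ 0) → ∀ L → p ^ ∑ L d ≤ B * B
p^∑≤B*B {p} {B} d 1≤B d≤2 d≡0 L = ≤-trans (bound L) (*-mono-≤ (m⊓n≤n (p ^ L) B) (m⊓n≤n (p ^ L) B))
  where
  μ : ℕ → ℕ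
  μ L = p ^ L ⊓ B
  bound : ∀ L → p ^ ∑ L d ≤ μ L * μ L
  bound zero    = *-mono-≤ (⊓-glb ≤-refl 1≤B) (⊓-glb ≤-refl 1≤B)
  bound (suc L) with p ^ suc L ≤? B
  ... | yes p^[1+L]≤B = begin
    p ^ (∑ L d + d (suc L))         ≡⟨ ^-distribˡ-+-* p (∑ L d) (d (suc L)) ⟩
    p ^ ∑ L d * p ^ d (suc L)       ≤⟨ *-mono-≤ (bound L) (^-monoʳ-≤ p (d≤2 L)) ⟩
    μ L * μ L * p ^ 2               ≤⟨ *-monoˡ-≤ (p ^ 2) (*-mono-≤ (m⊓n≤m (p ^ L) B) (m⊓n≤m (p ^ L) B)) ⟩
    p ^ L * p ^ L * p ^ 2           ≡⟨ regroup (p ^ L) p ⟩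
    p ^ suc L * p ^ suc L           ≡⟨ sym (cong₂ _*_ (m≤n⇒m⊓n≡m p^[1+L]≤B) (m≤n⇒m⊓n≡m p^[1+L]≤B)) ⟩
    μ (suc L) * μ (suc L)           ∎
    where
    open ≤-Reasoning
    regroup : ∀ x p → x * x * (p * (p * 1)) ≡ p * x * (p * x)
    regroup = ℕ-solve
  ... | no p^[1+L]≰B = begin
    p ^ (∑ L d + d (suc L))         ≡⟨ cong (λ e → p ^ (∑ L d + e)) (d≡0 L (≰⇒> p^[1+L]≰B)) ⟩
    p ^ (∑ L d + 0)                 ≡⟨ cong (p ^_) (+-identityʳ (∑ L d)) ⟩
    p ^ ∑ L d                       ≤⟨ bound L ⟩
    μ L * μ L                       ≤⟨ *-mono-≤ μ-mono μ-mono ⟩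
    μ (suc L) * μ (suc L)           ∎
    where
    open ≤-Reasoning
    μ-mono : μ L ≤ μ (suc L)
    μ-mono = ⊓-monoˡ-≤ B (^-monoʳ-≤ p (n≤1+n L))

module Digits (k : ℕ) where

  private
    p = suc k

  infixl 7 _/p^_
  _/p^_ : ℕ → ℕ → ℕ
  n /p^ j = n / p ^ j
    where instance _ = m^n≢0 p j

  quotSum : ℕ → ℕ → ℕ
  quotSum L n = ∑[ j ≤ L ] (n /p^ j)

  -- The first L base-p digits of n, plus the part ⌊n / p^L⌋ not yet expanded.
  digitSum : ℕ → ℕ → ℕ
  digitSum zero    n = n
  digitSum (suc L) n = n % p + digitSum L (n / p)

  quotSum-suc : ∀ L n → quotSum (suc L) n ≡ n / p + quotSum L (n / p)
  quotSum-suc L n = begin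
    quotSum (suc L) n                  ≡⟨ ∑-shift (n /p^_) L ⟩
    n /p^ 1 + ∑[ j ≤ L ] (n /p^ suc j) ≡⟨ cong₂ _+_ (/-congʳ {m = n} (*-identityʳ p)) (∑-cong L (λ {j} _ _ → sym (m/n/o≡m/[n*o] n p (p ^ j) {{_}} {{m^n≢0 p j}} {{m^n≢0 p (suc j)}}))) ⟩
    n / p + quotSum L (n / p)                ∎
    where open ≡-Reasoning

  n≡k*quotSum+digitSum : ∀ L n → n ≡ k * quotSum L n + digitSum L n
  n≡k*quotSum+digitSum zero    n = sym (cong (_+ n) (*-zeroʳ k))
  n≡k*quotSum+digitSum (suc L) n = begin
    n                                               ≡⟨ m≡m%n+[m/n]*n n p ⟩
    n % p + q * p                                   ≡⟨ expand k (n % p) q ⟩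
    k * q + (n % p + q)                             ≡⟨ cong (λ x → k * q + (n % p + x)) (n≡k*quotSum+digitSum L q) ⟩
    k * q + (n % p + (k * quotSum L q + digitSum L q)) ≡⟨ regroup k q (quotSum L q) (n % p) (digitSum L q) ⟩
    k * (q + quotSum L q) + digitSum (suc L) n      ≡⟨ cong (λ x → k * x + digitSum (suc L) n) (sym (quotSum-suc L n)) ⟩
    k * quotSum (suc L) n + digitSum (suc L) n      ∎
    where
    open ≡-Reasoning
    q = n / p
    expand : ∀ k r q → r + q * suc k ≡ k * q + (r + q)
    expand = ℕ-solve
    regroup : ∀ k q Q r s → k * q + (r + (k * Q + s)) ≡ k * (q + Q) + (r + s)
    regroup = ℕ-solve

  digitSum-< : ∀ L {n} → n < p → digitSum L n ≡ n
  digitSum-< zero    n<p = refl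
  digitSum-< (suc L) {n} n<p = begin
    n % p + digitSum L (n / p) ≡⟨ cong₂ _+_ (m<n⇒m%n≡m n<p) (cong (digitSum L) (m<n⇒m/n≡0 n<p)) ⟩
    n + digitSum L 0           ≡⟨ cong (_+_ n) (digitSum-< L (s≤s z≤n)) ⟩
    n + 0                      ≡⟨ +-identityʳ n ⟩
    n                          ∎
    where open ≡-Reasoning

  -- Each digit is at most k, and there are at most 1 + log_p n nonzero ones.
  p^digitSum≤[p*n]^k : ∀ L n → 1 ≤ n → n < p ^ L → p ^ digitSum L n ≤ (p * n) ^ k
  p^digitSum≤[p*n]^k zero    n 1≤n n<1 = ⊥-elim (<-irrefl refl (≤-trans (s≤s 1≤n) n<1))
  p^digitSum≤[p*n]^k (suc L) n 1≤n n<p^[1+L] with n / p ≟ 0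
  ... | yes q≡0 = begin
    p ^ (n % p + digitSum L (n / p)) ≡⟨ cong (λ x → p ^ (n % p + digitSum L x)) q≡0 ⟩
    p ^ (n % p + digitSum L 0)       ≡⟨ cong (λ x → p ^ (n % p + x)) (digitSum-< L (s≤s z≤n)) ⟩
    p ^ (n % p + 0)                  ≤⟨ ^-monoʳ-≤ p (≤-trans (≤-reflexive (+-identityʳ (n % p))) (≤-pred (m%n<n n p))) ⟩
    p ^ k                            ≤⟨ ^-monoˡ-≤ k (m≤m*n p n {{>-nonZero 1≤n}}) ⟩
    (p * n) ^ k                      ∎
    where open ≤-Reasoning
  ... | no q≢0 = begin
    p ^ (n % p + digitSum L q)   ≡⟨ ^-distribˡ-+-* p (n % p) (digitSum L q) ⟩
    p ^ (n % p) * p ^ digitSum L q ≤⟨ *-mono-≤ (^-monoʳ-≤ p (≤-pred (m%n<n n p))) ih ⟩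
    p ^ k * (p * q) ^ k          ≡⟨ sym (^-distribʳ-* p (p * q) k) ⟩
    (p * (p * q)) ^ k            ≤⟨ ^-monoˡ-≤ k (*-monoʳ-≤ p p*q≤n) ⟩
    (p * n) ^ k                  ∎
    where
    open ≤-Reasoning
    q = n / p
    p*q≤n : p * q ≤ n
    p*q≤n = subst (_≤ n) (*-comm q p) (m/n*n≤m n p)
    ih : p ^ digitSum L q ≤ (p * q) ^ k
    ih = p^digitSum≤[p*n]^k L q (n≢0⇒n>0 q≢0) (m<n*o⇒m/o<n (subst (n <_) (*-comm p (p ^ L)) n<p^[1+L]))

  p^digitSum≤n^[2k] : ∀ L {n} → 2 ≤ n → n < p ^ L → p ^ digitSum L n ≤ n ^ (2 * k)
  p^digitSum≤n^[2k] L {n} 2≤n n<p^L with n <? p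
  ... | yes n<p = subst (λ s → p ^ s ≤ n ^ (2 * k)) (sym (digitSum-< L n<p)) (m^n≤n^[2*[m∸1]] 2≤n n<p)
  ... | no n≮p = begin
    p ^ digitSum L n  ≤⟨ p^digitSum≤[p*n]^k L n (≤-trans (s≤s z≤n) 2≤n) n<p^L ⟩
    (p * n) ^ k       ≤⟨ ^-monoˡ-≤ k (*-monoˡ-≤ n (≮⇒≥ n≮p)) ⟩
    (n * n) ^ k       ≡⟨ cong (λ x → (n * x) ^ k) (sym (*-identityʳ n)) ⟩
    (n ^ 2) ^ k       ≡⟨ ^-*-assoc n 2 k ⟩
    n ^ (2 * k)       ∎
    where open ≤-Reasoning

  ∑≡ρ*quotSum+excess : ∀ {N : ℕ → ℕ} {ρ B} n → 1 ≤ B →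
    (∀ j → ρ * (n /p^ suc j) ≤ N (suc j) × N (suc j) ≤ ρ * (n /p^ suc j) + 2) →
    (∀ j → B < p ^ suc j → N (suc j) ≡ 0) →
    ∀ L → ∃[ E ] ∑ L N ≡ ρ * quotSum L n + E × p ^ E ≤ B * B
  ∑≡ρ*quotSum+excess {N} {ρ} {B} n 1≤B bounds N≡0 L = ∑ L d , ∑N≡ , p^∑≤B*B d 1≤B d≤2 d≡0 L
    where
    d : ℕ → ℕ
    d j = N j ∸ ρ * (n /p^ j)
    d≤2 : ∀ j → d (suc j) ≤ 2
    d≤2 j = ≤-trans (∸-monoˡ-≤ (ρ * (n /p^ suc j)) (proj₂ (bounds j))) (≤-reflexive (m+n∸m≡n (ρ * (n /p^ suc j)) 2))
    d≡0 : ∀ j → B < p ^ suc j → d (suc j) ≡ 0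
    d≡0 j B<p^[1+j] = trans (cong (_∸ ρ * (n /p^ suc j)) (N≡0 j B<p^[1+j])) (0∸n≡0 (ρ * (n /p^ suc j)))
    ∑N≡ : ∑ L N ≡ ρ * quotSum L n + ∑ L d
    ∑N≡ = begin
      ∑ L N                                   ≡⟨ ∑-cong L (λ { {suc j} _ _ → sym (m+[n∸m]≡n (proj₁ (bounds j))) }) ⟩
      ∑[ j ≤ L ] (ρ * (n /p^ j) + d j)        ≡⟨ ∑-distrib-+ L ⟩
      ∑[ j ≤ L ] (ρ * (n /p^ j)) + ∑ L d      ≡⟨ cong (_+ ∑ L d) (∑-distribˡ-* ρ L) ⟩
      ρ * quotSum L n + ∑ L d                 ∎
      where open ≡-Reasoning

module _ {p : ℕ} where

  IsExponent-unique : ∀ {m u w} → IsExponent p m u → IsExponent p m w → u ≡ w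
  IsExponent-unique {u = u} {w} (p^u∣m , p^1+u∤m) (p^w∣m , p^1+w∤m) with <-cmp u w
  ... | tri< u<w _ _ = ⊥-elim (p^1+u∤m (∣-trans (^-monoʳ-∣ p u<w) p^w∣m))
  ... | tri≈ _ u≡w _ = u≡w
  ... | tri> _ _ w<u = ⊥-elim (p^1+w∤m (∣-trans (^-monoʳ-∣ p w<u) p^u∣m))

  ∑χ[p^j∣m]≡L : ∀ L {m} → p ^ L ∣ m → ∑[ j ≤ L ] χ (p ^ j ∣? m) ≡ L
  ∑χ[p^j∣m]≡L zero    _     = refl
  ∑χ[p^j∣m]≡L (suc L) p^L∣m =
    trans (cong₂ _+_ (∑χ[p^j∣m]≡L L (∣-trans (^-monoʳ-∣ p (n≤1+n L)) p^L∣m)) (χ-yes (p ^ suc L ∣? _) p^L∣m))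
          (+-comm L 1)

  IsExponent-∑χ : ∀ L {m} → ¬ p ^ suc L ∣ m → IsExponent p m (∑[ j ≤ L ] χ (p ^ j ∣? m))
  IsExponent-∑χ zero    {m} p∤m = 1∣ m , p∤m
  IsExponent-∑χ (suc L) {m} p^[2+L]∤m with p ^ suc L ∣? m
  ... | yes p^[1+L]∣m = subst (IsExponent p m) (sym (trans (cong (_+ 1) (∑χ[p^j∣m]≡L L p^L∣m)) (+-comm L 1)))
                               (p^[1+L]∣m , p^[2+L]∤m)
    where p^L∣m = ∣-trans (^-monoʳ-∣ p (n≤1+n L)) p^[1+L]∣m
  ... | no p^[1+L]∤m = subst (IsExponent p m) (sym (+-identityʳ (∑[ j ≤ L ] χ (p ^ j ∣? m)))) (IsExponent-∑χ L p^[1+L]∤m)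

coprime-^ˡ : ∀ {p u} j → Coprime p u → Coprime (p ^ j) u
coprime-^ˡ zero    _      (d∣1 , _)   = ∣1⇒≡1 d∣1
coprime-^ˡ (suc j) p⊥u {d} (d∣p^[1+j] , d∣u) =
  coprime-^ˡ j p⊥u (coprime-factors p⊥u (d∣p^[1+j] , ∣m⇒∣m*n _ d∣u) , d∣u)

module _ {p : ℕ} (pp : Prime p) where

  private instance
    _ = prime⇒nonZero pp

  ∤⇒coprime : ∀ {u} → ¬ p ∣ u → Coprime p u
  ∤⇒coprime p∤u (d∣p , d∣u) with prime⇒irreducible pp d∣p
  ... | inj₁ d≡1 = d≡1
  ... | inj₂ refl = ⊥-elim (p∤u d∣u)

  ∤-* : ∀ {x y} → ¬ p ∣ x → ¬ p ∣ y → ¬ p ∣ x * y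
  ∤-* {x} {y} p∤x p∤y p∣xy with euclidsLemma x y pp p∣xy
  ... | inj₁ p∣x = p∤x p∣x
  ... | inj₂ p∣y = p∤y p∣y

  ^-∣-cancelˡ-* : ∀ j {u x} → ¬ p ∣ u → p ^ j ∣ u * x → p ^ j ∣ x
  ^-∣-cancelˡ-* j p∤u = coprime-divisor (coprime-^ˡ j (∤⇒coprime p∤u))

  IsExponent-* : ∀ {x y u w} → IsExponent p x u → IsExponent p y w → IsExponent p (x * y) (u + w)
  IsExponent-* {x} {y} {u} {w} (divides x′ x≡x′*p^u , p^1+u∤x) (divides y′ y≡y′*p^w , p^1+w∤y) =
    divides (x′ * y′) xy≡x′y′*p^[u+w] , p^1+u+w∤xy
    where
    instance _ = m^n≢0 p (u + w)
    xy≡x′y′*p^[u+w] : x * y ≡ x′ * y′ * p ^ (u + w)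
    xy≡x′y′*p^[u+w] = begin
      x * y                         ≡⟨ cong₂ _*_ x≡x′*p^u y≡y′*p^w ⟩
      x′ * p ^ u * (y′ * p ^ w)     ≡⟨ interchange x′ (p ^ u) y′ (p ^ w) ⟩
      x′ * y′ * (p ^ u * p ^ w)     ≡⟨ cong (x′ * y′ *_) (sym (^-distribˡ-+-* p u w)) ⟩
      x′ * y′ * p ^ (u + w)         ∎
      where
      open ≡-Reasoning
      interchange : ∀ a b c d → a * b * (c * d) ≡ a * c * (b * d)
      interchange = ℕ-solve
    p∤x′ : ¬ p ∣ x′
    p∤x′ p∣x′ = p^1+u∤x (subst (p * p ^ u ∣_) (sym x≡x′*p^u) (*-monoˡ-∣ (p ^ u) p∣x′))
    p∤y′ : ¬ p ∣ y′
    p∤y′ p∣y′ = p^1+w∤y (subst (p * p ^ w ∣_) (sym y≡y′*p^w) (*-monoˡ-∣ (p ^ w) p∣y′))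
    p^1+u+w∤xy : ¬ p ^ suc (u + w) ∣ x * y
    p^1+u+w∤xy d = ∤-* p∤x′ p∤y′ (*-cancelʳ-∣ (p ^ (u + w)) (subst (p * p ^ (u + w) ∣_) xy≡x′y′*p^[u+w] d))

∤-2aD : ∀ {p a D} → ¬ p ∣ ∣ + 2 ℤ.* a ℤ.* D ∣ → (¬ p ∣ 2) × (¬ p ∣ ∣ a ∣) × (¬ p ∣ ∣ D ∣)
∤-2aD {p} {a} {D} p∤2aD =
  (λ p∣2 → p∤2aD′ (∣m⇒∣m*n ∣ D ∣ (∣m⇒∣m*n ∣ a ∣ p∣2))) ,
  (λ p∣a → p∤2aD′ (∣m⇒∣m*n ∣ D ∣ (∣n⇒∣m*n 2 p∣a))) ,
  (λ p∣D → p∤2aD′ (∣n⇒∣m*n (2 * ∣ a ∣) p∣D))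
  where
  p∤2aD′ : ¬ p ∣ 2 * ∣ a ∣ * ∣ D ∣
  p∤2aD′ = p∤2aD ∘ subst (p ∣_) (sym (trans (ℤP.abs-* (+ 2 ℤ.* a) D) (cong (_* ∣ D ∣) (ℤP.abs-* (+ 2) a))))

∣[a-b]⇒∣a⇔∣b : ∀ {m a b} → m ℤD.∣ a ℤ.- b → (m ℤD.∣ a ⇔ m ℤD.∣ b)
∣[a-b]⇒∣a⇔∣b {a = a} {b} m∣a-b = mk⇔
  (λ m∣a → subst (_ ℤD.∣_) (a-[a-b]≡b a b) (ℤD.∣m∣n⇒∣m-n m∣a m∣a-b))
  (λ m∣b → subst (_ ℤD.∣_) (a-b+b≡a a b) (ℤD.∣m∣n⇒∣m+n m∣a-b m∣b))
  where
  a-[a-b]≡b : ∀ a b → a ℤ.- (a ℤ.- b) ≡ b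
  a-[a-b]≡b = ℤ-solve
  a-b+b≡a : ∀ a b → a ℤ.- b ℤ.+ b ≡ a
  a-b+b≡a = ℤ-solve

pos-affine : ∀ c y n → + (c + y * n) ≡ + c ℤ.+ + y ℤ.* + n
pos-affine c y n = trans (ℤP.pos-+ c (y * n)) (cong (ℤ._+_ (+ c)) (ℤP.pos-* y n))

coprime-∣-cancelˡ : ∀ {m} u {x} → Coprime m ∣ u ∣ → + m ℤD.∣ u ℤ.* x → + m ℤD.∣ x
coprime-∣-cancelˡ {m} u {x} m⊥u m∣ux =
  ℤD.∣ᵤ⇒∣ (coprime-divisor m⊥u (subst (m ∣_) (ℤP.abs-* u x) (ℤD.∣⇒∣ᵤ m∣ux)))

inverse-ℕ : ∀ {m n} → Bézout.Identity 1 m n → ∃[ s ] (+ m ℤD.∣ + n ℤ.* s ℤ.- 1ℤ)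
inverse-ℕ {m} {n} (Bézout.+- x y 1+y*n≡x*m) = ℤ.- + y , ℤD.divides (ℤ.- + x) (begin
  + n ℤ.* ℤ.- + y ℤ.- 1ℤ      ≡⟨ rearrange (+ n) (+ y) ⟩
  ℤ.- (+ 1 ℤ.+ + y ℤ.* + n)   ≡⟨ cong ℤ.-_ (sym (pos-affine 1 y n)) ⟩
  ℤ.- + (1 + y * n)            ≡⟨ cong (λ z → ℤ.- + z) 1+y*n≡x*m ⟩
  ℤ.- + (x * m)                ≡⟨ cong ℤ.-_ (ℤP.pos-* x m) ⟩
  ℤ.- (+ x ℤ.* + m)            ≡⟨ ℤP.neg-distribˡ-* (+ x) (+ m) ⟩
  ℤ.- + x ℤ.* + m              ∎)
  where
  open ≡-Reasoning
  rearrange : ∀ n y → n ℤ.* ℤ.- y ℤ.- 1ℤ ≡ ℤ.- (1ℤ ℤ.+ y ℤ.* n)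
  rearrange = ℤ-solve
inverse-ℕ {m} {n} (Bézout.-+ x y 1+x*m≡y*n) = + y , ℤD.divides (+ x) (begin
  + n ℤ.* + y ℤ.- 1ℤ          ≡⟨ cong (ℤ._- 1ℤ) (ℤP.*-comm (+ n) (+ y)) ⟩
  + y ℤ.* + n ℤ.- 1ℤ          ≡⟨ cong (ℤ._- 1ℤ) (sym (ℤP.pos-* y n)) ⟩
  + (y * n) ℤ.- 1ℤ            ≡⟨ cong (λ z → + z ℤ.- 1ℤ) (sym 1+x*m≡y*n) ⟩
  + (1 + x * m) ℤ.- 1ℤ        ≡⟨ cong (ℤ._- 1ℤ) (pos-affine 1 x m) ⟩
  1ℤ ℤ.+ + x ℤ.* + m ℤ.- 1ℤ   ≡⟨ cancel (+ x ℤ.* + m) ⟩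
  + x ℤ.* + m                 ∎)
  where
  open ≡-Reasoning
  cancel : ∀ z → 1ℤ ℤ.+ z ℤ.- 1ℤ ≡ z
  cancel = ℤ-solve

inverse : ∀ {m} v → Coprime m ∣ v ∣ → ∃[ s ] (+ m ℤD.∣ v ℤ.* s ℤ.- 1ℤ)
inverse {m} v m⊥v with inverse-ℕ (coprime-Bézout m⊥v) | ℤD.m∣∣m∣ {v}
... | s , m∣∣v∣s-1 | ℤD.divides σ ∣v∣≡σv =
  σ ℤ.* s , subst (λ z → + m ℤD.∣ z ℤ.- 1ℤ) (trans (cong (ℤ._* s) ∣v∣≡σv) (reassoc σ v s)) m∣∣v∣s-1
  where
  reassoc : ∀ σ v s → σ ℤ.* v ℤ.* s ≡ v ℤ.* (σ ℤ.* s)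
  reassoc = ℤ-solve

-- For u invertible mod m, u i + w ≡ u (i + t) (mod m) with t the residue of u⁻¹ w.
linear-congruence : ∀ {m} .{{_ : NonZero m}} u w → Coprime m ∣ u ∣ →
                    ∃[ t ] t < m × (∀ i → + m ℤD.∣ u ℤ.* + i ℤ.+ w ⇔ m ∣ i + t)
linear-congruence {m} u w m⊥u = t , n%ℕd<d (s ℤ.* w) m , λ i → mk⇔ (to i) (from i)
  where
  s = proj₁ (inverse u m⊥u)
  m∣us-1 = proj₂ (inverse u m⊥u)
  t = (s ℤ.* w) %ℕ m
  q = (s ℤ.* w) /ℕ m
  sw≡t+qm : s ℤ.* w ≡ + t ℤ.+ q ℤ.* + m
  sw≡t+qm = a≡a%ℕn+[a/ℕn]*n (s ℤ.* w) m
  m∣u[i+t]-[ui+w] : ∀ i → + m ℤD.∣ u ℤ.* + (i + t) ℤ.- (u ℤ.* + i ℤ.+ w)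
  m∣u[i+t]-[ui+w] i = subst (+ m ℤD.∣_) (sym (begin
    u ℤ.* + (i + t) ℤ.- (u ℤ.* + i ℤ.+ w)           ≡⟨ cong (λ z → u ℤ.* z ℤ.- (u ℤ.* + i ℤ.+ w)) (ℤP.pos-+ i t) ⟩
    u ℤ.* (+ i ℤ.+ + t) ℤ.- (u ℤ.* + i ℤ.+ w)       ≡⟨ expand u (+ i) (+ t) w q (+ m) ⟩
    u ℤ.* (+ t ℤ.+ q ℤ.* + m) ℤ.- w ℤ.- u ℤ.* q ℤ.* + m ≡⟨ cong (λ z → u ℤ.* z ℤ.- w ℤ.- u ℤ.* q ℤ.* + m) (sym sw≡t+qm) ⟩
    u ℤ.* (s ℤ.* w) ℤ.- w ℤ.- u ℤ.* q ℤ.* + m        ≡⟨ collect u s w q (+ m) ⟩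
    (u ℤ.* s ℤ.- 1ℤ) ℤ.* w ℤ.- u ℤ.* q ℤ.* + m        ∎))
    (ℤD.∣m∣n⇒∣m-n (ℤD.∣m⇒∣m*n w m∣us-1) (ℤD.∣n⇒∣m*n (u ℤ.* q) ℤD.∣-refl))
    where
    open ≡-Reasoning
    expand : ∀ u i t w q m → u ℤ.* (i ℤ.+ t) ℤ.- (u ℤ.* i ℤ.+ w) ≡ u ℤ.* (t ℤ.+ q ℤ.* m) ℤ.- w ℤ.- u ℤ.* q ℤ.* m
    expand = ℤ-solve
    collect : ∀ u s w q m → u ℤ.* (s ℤ.* w) ℤ.- w ℤ.- u ℤ.* q ℤ.* m ≡ (u ℤ.* s ℤ.- 1ℤ) ℤ.* w ℤ.- u ℤ.* q ℤ.* m
    collect = ℤ-solve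
  to : ∀ i → + m ℤD.∣ u ℤ.* + i ℤ.+ w → m ∣ i + t
  to i m∣ui+w = ℤD.∣⇒∣ᵤ (coprime-∣-cancelˡ u m⊥u (Equivalence.from (∣[a-b]⇒∣a⇔∣b (m∣u[i+t]-[ui+w] i)) m∣ui+w))
  from : ∀ i → m ∣ i + t → + m ℤD.∣ u ℤ.* + i ℤ.+ w
  from i m∣i+t = Equivalence.to (∣[a-b]⇒∣a⇔∣b (m∣u[i+t]-[ui+w] i)) (ℤD.∣n⇒∣m*n u (ℤD.∣ᵤ⇒∣ m∣i+t))

-- Square roots modulo prime powers

infix 4 _²≡_mod_
_²≡_mod_ : ℤ → ℤ → ℕ → Set
y ²≡ D mod m = + m ℤD.∣ y ℤ.* y ℤ.- D

p∣p^[1+j] : ∀ p j {z} → + (p ^ suc j) ℤD.∣ z → + p ℤD.∣ z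
p∣p^[1+j] p j = ℤD.∣-trans (ℤD.∣ᵤ⇒∣ (m∣m*n (p ^ j)))

module SquareRoots {p : ℕ} (pp : Prime p) (p∤2 : ¬ p ∣ 2) (D : ℤ) (p∤D : ¬ p ∣ ∣ D ∣) where

  private instance
    _ = prime⇒nonZero pp

  -- (X + y) − (X − y) = 2y, and p ∣ y would force p ∣ D.
  ∣X-y∣X+y⇒⊥ : ∀ X y → y ²≡ D mod p → + p ℤD.∣ X ℤ.- y → + p ℤD.∣ X ℤ.+ y → ⊥
  ∣X-y∣X+y⇒⊥ X y y²≡D p∣X-y p∣X+y = p∤D (ℤD.∣⇒∣ᵤ p∣D)
    where
    twice : ∀ X y → X ℤ.+ y ℤ.- (X ℤ.- y) ≡ + 2 ℤ.* y
    twice = ℤ-solve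
    p∣2y : p ∣ 2 * ∣ y ∣
    p∣2y = subst (p ∣_) (ℤP.abs-* (+ 2) y) (ℤD.∣⇒∣ᵤ (subst (+ p ℤD.∣_) (twice X y) (ℤD.∣m∣n⇒∣m-n p∣X+y p∣X-y)))
    p∣y : + p ℤD.∣ y
    p∣y with euclidsLemma 2 ∣ y ∣ pp p∣2y
    ... | inj₁ p∣2 = ⊥-elim (p∤2 p∣2)
    ... | inj₂ p∣y = ℤD.∣ᵤ⇒∣ p∣y
    y²-[y²-D]≡D : ∀ y D → y ℤ.* y ℤ.- (y ℤ.* y ℤ.- D) ≡ D
    y²-[y²-D]≡D = ℤ-solve
    p∣D : + p ℤD.∣ D
    p∣D = subst (+ p ℤD.∣_) (y²-[y²-D]≡D y D) (ℤD.∣m∣n⇒∣m-n (ℤD.∣m⇒∣m*n y p∣y) y²≡D)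

  p∤2y : ∀ y → y ²≡ D mod p → ¬ p ∣ ∣ + 2 ℤ.* y ∣
  p∤2y y y²≡D p∣2y = ∣X-y∣X+y⇒⊥ y y y²≡D (subst (+ p ℤD.∣_) (sym (ℤP.+-inverseʳ y)) (ℤD.divides 0ℤ refl))
                                        (subst (+ p ℤD.∣_) (two-y y) (ℤD.∣ᵤ⇒∣ p∣2y))
    where
    two-y : ∀ y → + 2 ℤ.* y ≡ y ℤ.+ y
    two-y = ℤ-solve

  -- Hensel: if y² − D = h pʲ⁺¹ then y − h s pʲ⁺¹ is a root mod pʲ⁺², where s inverts 2y mod p.
  lift-root : ∀ j y → y ²≡ D mod p ^ suc j → ∃[ y′ ] y′ ²≡ D mod p ^ suc (suc j)
  lift-root j y (ℤD.divides h y²-D≡hP) = y′ , subst (+ (p * P) ℤD.∣_) (sym y′²-D≡P*inner) p*P∣P*inner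
    where
    P = p ^ suc j
    p∣P : + p ℤD.∣ + P
    p∣P = ℤD.∣ᵤ⇒∣ (m∣m*n (p ^ j))
    p⊥2y = ∤⇒coprime pp (p∤2y y (p∣p^[1+j] p j (ℤD.divides h y²-D≡hP)))
    s = proj₁ (inverse (+ 2 ℤ.* y) p⊥2y)
    p∣2ys-1 = proj₂ (inverse (+ 2 ℤ.* y) p⊥2y)
    t = ℤ.- h ℤ.* s
    y′ = y ℤ.+ t ℤ.* + P
    inner = h ℤ.+ + 2 ℤ.* y ℤ.* t ℤ.+ t ℤ.* t ℤ.* + P
    y′²-D≡P*inner : y′ ℤ.* y′ ℤ.- D ≡ + P ℤ.* inner
    y′²-D≡P*inner = begin
      y′ ℤ.* y′ ℤ.- D                            ≡⟨ expand y D t (+ P) ⟩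
      y ℤ.* y ℤ.- D ℤ.+ (+ 2 ℤ.* y ℤ.* t ℤ.+ t ℤ.* t ℤ.* + P) ℤ.* + P ≡⟨ cong (λ z → z ℤ.+ (+ 2 ℤ.* y ℤ.* t ℤ.+ t ℤ.* t ℤ.* + P) ℤ.* + P) y²-D≡hP ⟩
      h ℤ.* + P ℤ.+ (+ 2 ℤ.* y ℤ.* t ℤ.+ t ℤ.* t ℤ.* + P) ℤ.* + P ≡⟨ factor h y t (+ P) ⟩
      + P ℤ.* inner                              ∎
      where
      open ≡-Reasoning
      expand : ∀ y D t P → (y ℤ.+ t ℤ.* P) ℤ.* (y ℤ.+ t ℤ.* P) ℤ.- D
                         ≡ y ℤ.* y ℤ.- D ℤ.+ (+ 2 ℤ.* y ℤ.* t ℤ.+ t ℤ.* t ℤ.* P) ℤ.* P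
      expand = ℤ-solve
      factor : ∀ h y t P → h ℤ.* P ℤ.+ (+ 2 ℤ.* y ℤ.* t ℤ.+ t ℤ.* t ℤ.* P) ℤ.* P
                         ≡ P ℤ.* (h ℤ.+ + 2 ℤ.* y ℤ.* t ℤ.+ t ℤ.* t ℤ.* P)
      factor = ℤ-solve
    h+2yt≡-h[2ys-1] : ∀ h y s → h ℤ.+ + 2 ℤ.* y ℤ.* (ℤ.- h ℤ.* s) ≡ ℤ.- h ℤ.* (+ 2 ℤ.* y ℤ.* s ℤ.- 1ℤ)
    h+2yt≡-h[2ys-1] = ℤ-solve
    p∣inner : + p ℤD.∣ inner
    p∣inner = ℤD.∣m∣n⇒∣m+n (subst (+ p ℤD.∣_) (sym (h+2yt≡-h[2ys-1] h y s)) (ℤD.∣n⇒∣m*n (ℤ.- h) p∣2ys-1))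
                           (ℤD.∣n⇒∣m*n (t ℤ.* t) p∣P)
    p*P∣P*inner : + (p * P) ℤD.∣ + P ℤ.* inner
    p*P∣P*inner = subst (ℤD._∣ + P ℤ.* inner) (trans (ℤP.*-comm (+ P) (+ p)) (sym (ℤP.pos-* p P)))
                        (ℤD.*-monoʳ-∣ (+ P) p∣inner)

  hensel : ∀ x → x ²≡ D mod p → ∀ j → ∃[ y ] y ²≡ D mod p ^ suc j
  hensel x x²≡D zero    = x , subst (λ m → x ²≡ D mod m) (sym (*-identityʳ p)) x²≡D
  hensel x x²≡D (suc j) = lift-root j (proj₁ (hensel x x²≡D j)) (proj₂ (hensel x x²≡D j))

  -- X² − D = (X − y)(X + y) + (y² − D), and p cannot divide both factors.
  root-split : ∀ j y → y ²≡ D mod p ^ suc j → ∀ X →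
               X ²≡ D mod p ^ suc j ⇔ (+ (p ^ suc j) ℤD.∣ X ℤ.- y ⊎ + (p ^ suc j) ℤD.∣ X ℤ.+ y)
  root-split j y y²≡D X = mk⇔ to from
    where
    m = p ^ suc j
    factor : ∀ X y D → X ℤ.* X ℤ.- D ≡ (X ℤ.- y) ℤ.* (X ℤ.+ y) ℤ.+ (y ℤ.* y ℤ.- D)
    factor = ℤ-solve
    X²-D⇔[X-y][X+y] : X ²≡ D mod m ⇔ + m ℤD.∣ (X ℤ.- y) ℤ.* (X ℤ.+ y)
    X²-D⇔[X-y][X+y] = mk⇔
      (λ m∣X²-D → ℤD.∣m+n∣n⇒∣m (subst (+ m ℤD.∣_) (factor X y D) m∣X²-D) y²≡D)
      (λ m∣prod → subst (+ m ℤD.∣_) (sym (factor X y D)) (ℤD.∣m∣n⇒∣m+n m∣prod y²≡D))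
    p∤⇒m⊥ : ∀ z → ¬ p ∣ ∣ z ∣ → Coprime m ∣ z ∣
    p∤⇒m⊥ z p∤z = coprime-^ˡ (suc j) (∤⇒coprime pp p∤z)
    to : X ²≡ D mod m → + m ℤD.∣ X ℤ.- y ⊎ + m ℤD.∣ X ℤ.+ y
    to m∣X²-D with p ∣? ∣ X ℤ.- y ∣
    ... | no p∤X-y  = inj₂ (coprime-∣-cancelˡ (X ℤ.- y) (p∤⇒m⊥ (X ℤ.- y) p∤X-y) (Equivalence.to X²-D⇔[X-y][X+y] m∣X²-D))
    ... | yes p∣X-y = inj₁ (coprime-∣-cancelˡ (X ℤ.+ y) (p∤⇒m⊥ (X ℤ.+ y) p∤X+y)
                             (subst (+ m ℤD.∣_) (ℤP.*-comm (X ℤ.- y) (X ℤ.+ y)) (Equivalence.to X²-D⇔[X-y][X+y] m∣X²-D)))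
      where
      p∤X+y : ¬ p ∣ ∣ X ℤ.+ y ∣
      p∤X+y p∣X+y = ∣X-y∣X+y⇒⊥ X y (p∣p^[1+j] p j y²≡D) (ℤD.∣ᵤ⇒∣ p∣X-y) (ℤD.∣ᵤ⇒∣ p∣X+y)
    from : + m ℤD.∣ X ℤ.- y ⊎ + m ℤD.∣ X ℤ.+ y → X ²≡ D mod m
    from (inj₁ m∣X-y) = Equivalence.from X²-D⇔[X-y][X+y] (ℤD.∣m⇒∣m*n (X ℤ.+ y) m∣X-y)
    from (inj₂ m∣X+y) = Equivalence.from X²-D⇔[X-y][X+y] (ℤD.∣n⇒∣m*n (X ℤ.- y) m∣X+y)

  root-reduce : ∀ X → X ²≡ D mod p → ∃[ x ] x < p × + x ²≡ D mod p
  root-reduce X X²≡D = x , n%ℕd<d X p , subst (+ p ℤD.∣_) x²-D≡X²-D-pW (ℤD.∣m∣n⇒∣m-n X²≡D (ℤD.∣m⇒∣m*n _ ℤD.∣-refl))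
    where
    x = X %ℕ p
    q = X /ℕ p
    W = q ℤ.* (+ 2 ℤ.* + x ℤ.+ q ℤ.* + p)
    expand : ∀ x q p D → (x ℤ.+ q ℤ.* p) ℤ.* (x ℤ.+ q ℤ.* p) ℤ.- D ℤ.- p ℤ.* (q ℤ.* (+ 2 ℤ.* x ℤ.+ q ℤ.* p)) ≡ x ℤ.* x ℤ.- D
    expand = ℤ-solve
    x²-D≡X²-D-pW : X ℤ.* X ℤ.- D ℤ.- + p ℤ.* W ≡ + x ℤ.* + x ℤ.- D
    x²-D≡X²-D-pW = trans (cong (λ z → z ℤ.* z ℤ.- D ℤ.- + p ℤ.* W) (a≡a%ℕn+[a/ℕn]*n X p)) (expand (+ x) q (+ p) D)

rootCount : ℤ → ℕ → ℕ
rootCount D p = if isSquareMod D p then 2 else 0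

rootCount≤2 : ∀ D p → rootCount D p ≤ 2
rootCount≤2 D p with isSquareMod D p
... | true  = ≤-refl
... | false = z≤n

1+legendre≡rootCount : ∀ D p → ¬ p ∣ ∣ D ∣ → 1ℤ ℤ.+ legendre D p ≡ + rootCount D p
1+legendre≡rootCount D p p∤D with p ∣? ∣ D ∣ | isSquareMod D p
... | yes p∣D | _     = ⊥-elim (p∤D p∣D)
... | no _    | true  = refl
... | no _    | false = refl

T-does⇒ : ∀ {A : Set} (d : Dec A) → T (does d) → A
T-does⇒ (yes a) _ = a

T-does⇐ : ∀ {A : Set} (d : Dec A) → A → T (does d)
T-does⇐ (yes _) _ = _
T-does⇐ (no ¬a) a = ¬a a

isSquareMod-sound : ∀ D p → T (isSquareMod D p) → ∃[ x ] + x ²≡ D mod p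
isSquareMod-sound D p sq with satisfied (any⁻ (λ x → does (p ∣? ∣ + x ℤ.* + x ℤ.- D ∣)) (upTo p) sq)
... | x , p∣x²-D = x , ℤD.∣ᵤ⇒∣ (T-does⇒ (p ∣? _) p∣x²-D)

isSquareMod-complete : ∀ D p {x} → x < p → + x ²≡ D mod p → T (isSquareMod D p)
isSquareMod-complete D p x<p x²≡D =
  any⁺ (λ x → does (p ∣? ∣ + x ℤ.* + x ℤ.- D ∣)) (lose (∈-upTo⁺ x<p) (T-does⇐ (p ∣? _) (ℤD.∣⇒∣ᵤ x²≡D)))

deviation≡⊖ : ∀ D k K n → ¬ suc k ∣ ∣ D ∣ →
  + K ℤ.* (+ suc k ℤ.- 1ℤ) ℤ.- + n ℤ.* (1ℤ ℤ.+ legendre D (suc k)) ≡ (K * k) ℤ.⊖ (n * rootCount D (suc k))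
deviation≡⊖ D k K n p∤D = begin
  + K ℤ.* + k ℤ.- + n ℤ.* (1ℤ ℤ.+ legendre D (suc k))   ≡⟨ cong (λ z → + K ℤ.* + k ℤ.- + n ℤ.* z) (1+legendre≡rootCount D (suc k) p∤D) ⟩
  + K ℤ.* + k ℤ.- + n ℤ.* + ρ                          ≡⟨ cong₂ ℤ._-_ (sym (ℤP.pos-* K k)) (sym (ℤP.pos-* n ρ)) ⟩
  + (K * k) ℤ.- + (n * ρ)                              ≡⟨ ℤP.[+m]-[+n]≡m⊖n (K * k) (n * ρ) ⟩
  (K * k) ℤ.⊖ (n * ρ)                                  ∎
  where
  open ≡-Reasoning
  ρ = rootCount D (suc k)

-- Roots of f modulo prime powers

completing-square : ∀ a b c i → (+ 2 ℤ.* a ℤ.* + i ℤ.+ b) ℤ.* (+ 2 ℤ.* a ℤ.* + i ℤ.+ b) ℤ.- disc a b c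
                                ≡ + 4 ℤ.* a ℤ.* fZ a b c i
completing-square a b c i = identity a b c (+ i)
  where
  identity : ∀ a b c x → (+ 2 ℤ.* a ℤ.* x ℤ.+ b) ℤ.* (+ 2 ℤ.* a ℤ.* x ℤ.+ b) ℤ.- (b ℤ.* b ℤ.- + 4 ℤ.* a ℤ.* c)
                         ≡ + 4 ℤ.* a ℤ.* (a ℤ.* x ℤ.* x ℤ.+ b ℤ.* x ℤ.+ c)
  identity = ℤ-solve

-- A root i of f would give the factorisation f(x) = (x − i)(a x + b + a i).
fZ≢0 : ∀ {a b c} → Irreducible a b c → ∀ i → fZ a b c i ≢ 0ℤ
fZ≢0 {a} {b} {c} (_ , no-linear-factor) i fi≡0 =
  no-linear-factor 1ℤ (ℤ.- + i) a (b ℤ.+ a ℤ.* + i) (sym (ℤP.*-identityˡ a)) (b≡ a b (+ i)) c≡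
  where
  b≡ : ∀ a b x → b ≡ 1ℤ ℤ.* (b ℤ.+ a ℤ.* x) ℤ.+ ℤ.- x ℤ.* a
  b≡ = ℤ-solve
  c≡f[x]-x[b+ax] : ∀ a b c x → c ≡ a ℤ.* x ℤ.* x ℤ.+ b ℤ.* x ℤ.+ c ℤ.+ ℤ.- x ℤ.* (b ℤ.+ a ℤ.* x)
  c≡f[x]-x[b+ax] = ℤ-solve
  c≡ : c ≡ ℤ.- + i ℤ.* (b ℤ.+ a ℤ.* + i)
  c≡ = trans (c≡f[x]-x[b+ax] a b c (+ i)) (trans (cong (ℤ._+ ℤ.- + i ℤ.* (b ℤ.+ a ℤ.* + i)) fi≡0) (ℤP.+-identityˡ _))

∣fZ∣≤ : ∀ a b c {n i} → 1 ≤ n → i ≤ n → ∣ fZ a b c i ∣ ≤ (∣ a ∣ + ∣ b ∣ + ∣ c ∣) * (n * n)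
∣fZ∣≤ a b c {n} {i} 1≤n i≤n = begin
  abs (a ℤ.* + i ℤ.* + i ℤ.+ b ℤ.* + i ℤ.+ c)      ≤⟨ ℤP.∣i+j∣≤∣i∣+∣j∣ (a ℤ.* + i ℤ.* + i ℤ.+ b ℤ.* + i) c ⟩
  abs (a ℤ.* + i ℤ.* + i ℤ.+ b ℤ.* + i) + C         ≤⟨ +-monoˡ-≤ C (ℤP.∣i+j∣≤∣i∣+∣j∣ (a ℤ.* + i ℤ.* + i) (b ℤ.* + i)) ⟩
  abs (a ℤ.* + i ℤ.* + i) + abs (b ℤ.* + i) + C     ≡⟨ cong₂ (λ u v → u + v + C) (trans (ℤP.abs-* (a ℤ.* + i) (+ i)) (cong (_* i) (ℤP.abs-* a (+ i)))) (ℤP.abs-* b (+ i)) ⟩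
  A * i * i + B * i + C                             ≤⟨ +-mono-≤ (+-mono-≤ (*-mono-≤ (*-monoʳ-≤ A i≤n) i≤n) (*-monoʳ-≤ B (≤-trans i≤n n≤n*n)))
                                                                (≤-trans (≤-reflexive (sym (*-identityʳ C))) (*-monoʳ-≤ C (*-mono-≤ 1≤n 1≤n))) ⟩
  A * n * n + B * (n * n) + C * (n * n)             ≡⟨ collect A B C n ⟩
  (A + B + C) * (n * n)                             ∎
  where
  open ≤-Reasoning
  abs = ∣_∣
  A = ∣ a ∣
  B = ∣ b ∣
  C = ∣ c ∣
  n≤n*n : n ≤ n * n
  n≤n*n = m≤m*n n n {{>-nonZero 1≤n}}
  collect : ∀ a b c n → a * n * n + b * (n * n) + c * (n * n) ≡ (a + b + c) * (n * n)
  collect = ℕ-solve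

IsExponent-prodF : ∀ {p} → Prime p → ∀ a b c L n → (∀ {i} → 1 ≤ i → i ≤ n → ¬ p ^ suc L ∣ ∣ fZ a b c i ∣) →
                   IsExponent p ∣ prodF a b c n ∣ (∑[ j ≤ L ] ∑[ i ≤ n ] χ (p ^ j ∣? ∣ fZ a b c i ∣))
IsExponent-prodF {p} pp a b c L zero _ = subst (IsExponent p 1) (sym (∑-zero L (λ _ _ → refl))) (1∣ 1 , p∤1)
  where
  p∤1 : ¬ p * 1 ∣ 1
  p∤1 p∣1 = ¬prime[1] (subst Prime (trans (sym (*-identityʳ p)) (∣1⇒≡1 p∣1)) pp)
IsExponent-prodF {p} pp a b c L (suc n) p^[1+L]∤f =
  subst₂ (IsExponent p) (sym (ℤP.abs-* (prodF a b c n) (fZ a b c (suc n)))) (sym (∑-distrib-+ {old} {new} L))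
         (IsExponent-* pp {u = ∑ L old} {w = ∑ L new}
                       (IsExponent-prodF pp a b c L n (λ 1≤i i≤n → p^[1+L]∤f 1≤i (m≤n⇒m≤1+n i≤n)))
                       (IsExponent-∑χ {p} L (p^[1+L]∤f (s≤s z≤n) ≤-refl)))
  where
  old new : ℕ → ℕ
  old j = ∑[ i ≤ n ] χ (p ^ j ∣? ∣ fZ a b c i ∣)
  new j = χ (p ^ j ∣? ∣ fZ a b c (suc n) ∣)

module RootCount {k : ℕ} (pp : Prime (suc k)) (p∤2 : ¬ suc k ∣ 2) (a b c : ℤ)
                 (p∤a : ¬ suc k ∣ ∣ a ∣) (p∤D : ¬ suc k ∣ ∣ disc a b c ∣) where

  private
    p = suc k
    D = disc a b c

  open Digits k using (_/p^_)
  open SquareRoots pp p∤2 D p∤D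

  X : ℕ → ℤ
  X i = + 2 ℤ.* a ℤ.* + i ℤ.+ b

  p∤2a : ¬ p ∣ ∣ + 2 ℤ.* a ∣
  p∤2a p∣2a = ∤-* pp p∤2 p∤a (subst (p ∣_) (ℤP.abs-* (+ 2) a) p∣2a)

  p∤4a : ¬ p ∣ ∣ + 4 ℤ.* a ∣
  p∤4a p∣4a = ∤-* pp p∤2 (∤-* pp p∤2 p∤a) (subst (p ∣_) (trans (ℤP.abs-* (+ 4) a) (*-assoc 2 2 ∣ a ∣)) p∣4a)

  p^j∣f⇔X²≡D : ∀ j i → p ^ j ∣ ∣ fZ a b c i ∣ ⇔ X i ²≡ D mod p ^ j
  p^j∣f⇔X²≡D j i = mk⇔
    (λ p^j∣f → subst (+ (p ^ j) ℤD.∣_) (sym (completing-square a b c i)) (ℤD.∣n⇒∣m*n (+ 4 ℤ.* a) (ℤD.∣ᵤ⇒∣ p^j∣f)))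
    (λ X²≡D → ^-∣-cancelˡ-* pp j p∤4a
       (subst (p ^ j ∣_) (ℤP.abs-* (+ 4 ℤ.* a) (fZ a b c i)) (ℤD.∣⇒∣ᵤ (subst (+ (p ^ j) ℤD.∣_) (completing-square a b c i) X²≡D))))

  p^j⊥2a : ∀ j → Coprime (p ^ j) ∣ + 2 ℤ.* a ∣
  p^j⊥2a j = coprime-^ˡ j (∤⇒coprime pp p∤2a)

  -- pʲ ∣ f(i) iff 2ai + b ≡ ± y (mod pʲ) for a root y of D mod pʲ; each sign is one class of i mod pʲ.
  χ[p^j∣f]≡χ+χ : ∀ j y → y ²≡ D mod p ^ suc j → ∀ {t₁ t₂} →
    (∀ i → + (p ^ suc j) ℤD.∣ + 2 ℤ.* a ℤ.* + i ℤ.+ (b ℤ.- y) ⇔ p ^ suc j ∣ i + t₁) →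
    (∀ i → + (p ^ suc j) ℤD.∣ + 2 ℤ.* a ℤ.* + i ℤ.+ (b ℤ.+ y) ⇔ p ^ suc j ∣ i + t₂) →
    ∀ i → χ (p ^ suc j ∣? ∣ fZ a b c i ∣) ≡ χ (p ^ suc j ∣? i + t₁) + χ (p ^ suc j ∣? i + t₂)
  χ[p^j∣f]≡χ+χ j y y²≡D {t₁} {t₂} lin₁ lin₂ i =
    χ-⊎ (p ^ suc j ∣? ∣ fZ a b c i ∣) (p ^ suc j ∣? i + t₁) (p ^ suc j ∣? i + t₂)
        ((class₁ ⊎-⇔ class₂) ⇔-∘ (root-split j y y²≡D (X i) ⇔-∘ p^j∣f⇔X²≡D (suc j) i))
        (λ m∣i+t₁ m∣i+t₂ → ∣X-y∣X+y⇒⊥ (X i) y (p∣p^[1+j] p j y²≡D)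
           (p∣p^[1+j] p j (Equivalence.from class₁ m∣i+t₁)) (p∣p^[1+j] p j (Equivalence.from class₂ m∣i+t₂)))
    where
    assoc₁ : ∀ u x b y → u ℤ.* x ℤ.+ b ℤ.- y ≡ u ℤ.* x ℤ.+ (b ℤ.- y)
    assoc₁ = ℤ-solve
    assoc₂ : ∀ u x b y → u ℤ.* x ℤ.+ b ℤ.+ y ≡ u ℤ.* x ℤ.+ (b ℤ.+ y)
    assoc₂ = ℤ-solve
    class₁ : + (p ^ suc j) ℤD.∣ X i ℤ.- y ⇔ p ^ suc j ∣ i + t₁
    class₁ = subst (λ z → + (p ^ suc j) ℤD.∣ z ⇔ p ^ suc j ∣ i + t₁) (sym (assoc₁ (+ 2 ℤ.* a) (+ i) b y)) (lin₁ i)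
    class₂ : + (p ^ suc j) ℤD.∣ X i ℤ.+ y ⇔ p ^ suc j ∣ i + t₂
    class₂ = subst (λ z → + (p ^ suc j) ℤD.∣ z ⇔ p ^ suc j ∣ i + t₂) (sym (assoc₂ (+ 2 ℤ.* a) (+ i) b y)) (lin₂ i)

  two-classes : ∀ x → + x ²≡ D mod p → ∀ j → ∃[ t₁ ] ∃[ t₂ ] t₁ < p ^ suc j × t₂ < p ^ suc j ×
    (∀ i → χ (p ^ suc j ∣? ∣ fZ a b c i ∣) ≡ χ (p ^ suc j ∣? i + t₁) + χ (p ^ suc j ∣? i + t₂))
  two-classes x x²≡D j = case hensel (+ x) x²≡D j of λ where
    (y , y²≡D) → case linear-congruence {{m^n≢0 p (suc j)}} (+ 2 ℤ.* a) (b ℤ.- y) (p^j⊥2a (suc j))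
                   ,′ linear-congruence {{m^n≢0 p (suc j)}} (+ 2 ℤ.* a) (b ℤ.+ y) (p^j⊥2a (suc j)) of λ where
      ((t₁ , t₁<m , lin₁) , (t₂ , t₂<m , lin₂)) → t₁ , t₂ , t₁<m , t₂<m , χ[p^j∣f]≡χ+χ j y y²≡D lin₁ lin₂

  no-roots : (∀ x → x < p → ¬ + x ²≡ D mod p) → ∀ j i → ¬ p ^ suc j ∣ ∣ fZ a b c i ∣
  no-roots no-root j i p^[1+j]∣f =
    case root-reduce (X i) (p∣p^[1+j] p j (Equivalence.to (p^j∣f⇔X²≡D (suc j) i) p^[1+j]∣f)) of λ where
      (x , x<p , x²≡D) → no-root x x<p x²≡D

  N : ℕ → ℕ → ℕ
  N j n = ∑[ i ≤ n ] χ (p ^ j ∣? ∣ fZ a b c i ∣)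

  N-bounds : ∀ j n → rootCount D p * (n /p^ suc j) ≤ N (suc j) n × N (suc j) n ≤ rootCount D p * (n /p^ suc j) + 2
  N-bounds j n with isSquareMod D p in square
  ... | true  = case isSquareMod-sound D p (subst T (sym square) _) of λ where
    (x , x²≡D) → case two-classes x x²≡D j of λ where
      (t₁ , t₂ , t₁<m , t₂<m , χ≡χ+χ) →
        subst (λ N′ → 2 * (n /p^ suc j) ≤ N′ × N′ ≤ 2 * (n /p^ suc j) + 2)
              (sym (trans (∑-cong n (λ {i} _ _ → χ≡χ+χ i))
                      (trans (∑-distrib-+ n) (cong₂ _+_ (∑χ[m∣i+t]≡[n+t]/m (p ^ suc j) {{m^n≢0 p (suc j)}} t₁<m n)
                                                        (∑χ[m∣i+t]≡[n+t]/m (p ^ suc j) {{m^n≢0 p (suc j)}} t₂<m n)))))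
              (two-residues-bounds (p ^ suc j) {{m^n≢0 p (suc j)}} t₁<m t₂<m n)
  ... | false = z≤n , ≤-trans (≤-reflexive N≡0) z≤n
    where
    no-root : ∀ x → x < p → ¬ + x ²≡ D mod p
    no-root x x<p x²≡D = subst T square (isSquareMod-complete D p x<p x²≡D)
    N≡0 : N (suc j) n ≡ 0
    N≡0 = ∑-zero n (λ {i} _ _ → χ-no (p ^ suc j ∣? ∣ fZ a b c i ∣) (no-roots no-root j i))

-- Both sides lose the common term k ρ Q.
K*k⊖n*ρ≡E*k⊖ρ*s : ∀ {k n ρ K Q s E} → n ≡ k * Q + s → K ≡ ρ * Q + E → (K * k) ℤ.⊖ (n * ρ) ≡ (E * k) ℤ.⊖ (ρ * s)
K*k⊖n*ρ≡E*k⊖ρ*s {k} {n} {ρ} {K} {Q} {s} {E} refl refl = begin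
  ((ρ * Q + E) * k) ℤ.⊖ ((k * Q + s) * ρ)           ≡⟨ cong₂ ℤ._⊖_ (expand₁ k ρ Q E) (expand₂ k ρ Q s) ⟩
  (k * (ρ * Q) + E * k) ℤ.⊖ (k * (ρ * Q) + ρ * s)   ≡⟨ ℤP.+-cancelˡ-⊖ (k * (ρ * Q)) (E * k) (ρ * s) ⟩
  (E * k) ℤ.⊖ (ρ * s)                                ∎
  where
  open ≡-Reasoning
  expand₁ : ∀ k ρ Q E → (ρ * Q + E) * k ≡ k * (ρ * Q) + E * k
  expand₁ = ℕ-solve
  expand₂ : ∀ k ρ Q s → (k * Q + s) * ρ ≡ k * (ρ * Q) + ρ * s
  expand₂ = ℕ-solve

module Deviation (a b c : ℤ) (irr : Irreducible a b c) (1≤M : 1 ≤ ∣ a ∣ + ∣ b ∣ + ∣ c ∣)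
                 {k : ℕ} (pp : Prime (suc k)) (p∤2 : ¬ suc k ∣ 2) (p∤a : ¬ suc k ∣ ∣ a ∣)
                 (p∤D : ¬ suc k ∣ ∣ disc a b c ∣) {n : ℕ} (2≤n : 2 ≤ n) where

  private
    p = suc k
    D = disc a b c
    M = ∣ a ∣ + ∣ b ∣ + ∣ c ∣
    e = M + 2
    B = M * (n * n)
    ρ = rootCount D p
    1≤n : 1 ≤ n
    1≤n = ≤-trans (s≤s z≤n) 2≤n
    instance _ = >-nonZero 1≤n
    1<p : 1 < p
    1<p = nonTrivial⇒n>1 p {{prime⇒nonTrivial pp}}

  open Digits k
  open RootCount pp p∤2 a b c p∤a p∤D

  private
    1≤B : 1 ≤ B
    1≤B = *-mono-≤ 1≤M (*-mono-≤ 1≤n 1≤n)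

    n≤B : n ≤ B
    n≤B = ≤-trans (m≤n*m n M {{>-nonZero 1≤M}}) (*-monoʳ-≤ M (m≤m*n n n))

    B≤n^e : B ≤ n ^ e
    B≤n^e = begin
      M * (n * n)       ≤⟨ *-monoˡ-≤ (n * n) (≤-trans (<⇒≤ (n<m^n (s≤s (s≤s z≤n)) M)) (^-monoˡ-≤ M 2≤n)) ⟩
      n ^ M * (n * n)   ≡⟨ cong (λ x → n ^ M * (n * x)) (sym (*-identityʳ n)) ⟩
      n ^ M * n ^ 2     ≡⟨ sym (^-distribˡ-+-* n M 2) ⟩
      n ^ e             ∎
      where open ≤-Reasoning

    B<p^B : B < p ^ B
    B<p^B = n<m^n 1<p B

    p^j∤f : ∀ j {i} → 1 ≤ i → i ≤ n → B < p ^ j → ¬ p ^ j ∣ ∣ fZ a b c i ∣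
    p^j∤f j {i} 1≤i i≤n B<p^j p^j∣f = <-irrefl refl (begin-strict
      B                   <⟨ B<p^j ⟩
      p ^ j               ≤⟨ ∣⇒≤ {{≢-nonZero (fZ≢0 irr i ∘ ℤP.∣i∣≡0⇒i≡0)}} p^j∣f ⟩
      ∣ fZ a b c i ∣      ≤⟨ ∣fZ∣≤ a b c 1≤n i≤n ⟩
      B                   ∎)
      where open ≤-Reasoning

    α : ℕ
    α = ∑[ j ≤ B ] N j n

    IsExponent-α : IsExponent p ∣ prodF a b c n ∣ α
    IsExponent-α = IsExponent-prodF pp a b c B n
      (λ 1≤i i≤n → p^j∤f (suc B) 1≤i i≤n (<-≤-trans B<p^B (^-monoʳ-≤ p (n≤1+n B))))

    excess : ∃[ E ] α ≡ ρ * quotSum B n + E × p ^ E ≤ B * B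
    excess = ∑≡ρ*quotSum+excess {N = λ j → N j n} {ρ = ρ} {B = B} n 1≤B (λ j → N-bounds j n)
      (λ j B<p^[1+j] → ∑-zero n (λ {i} 1≤i i≤n → χ-no (p ^ suc j ∣? ∣ fZ a b c i ∣) (p^j∤f (suc j) 1≤i i≤n B<p^[1+j])))
      B

    E = proj₁ excess
    s = digitSum B n

    p^[E*k]≤ : p ^ (E * k) ≤ n ^ ((2 * e + 4) * k)
    p^[E*k]≤ = begin
      p ^ (E * k)           ≡⟨ sym (^-*-assoc p E k) ⟩
      (p ^ E) ^ k           ≤⟨ ^-monoˡ-≤ k (≤-trans (proj₂ (proj₂ excess)) (*-mono-≤ B≤n^e B≤n^e)) ⟩
      (n ^ e * n ^ e) ^ k   ≡⟨ cong (_^ k) (sym (^-distribˡ-+-* n e e)) ⟩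
      (n ^ (e + e)) ^ k     ≡⟨ ^-*-assoc n (e + e) k ⟩
      n ^ ((e + e) * k)     ≤⟨ ^-monoʳ-≤ n (*-monoˡ-≤ k (≤-trans (≤-reflexive (cong (_+_ e) (sym (+-identityʳ e)))) (m≤m+n (2 * e) 4))) ⟩
      n ^ ((2 * e + 4) * k) ∎
      where open ≤-Reasoning

    p^[ρ*s]≤ : p ^ (ρ * s) ≤ n ^ ((2 * e + 4) * k)
    p^[ρ*s]≤ = begin
      p ^ (ρ * s)           ≤⟨ ^-monoʳ-≤ p (*-monoˡ-≤ s (rootCount≤2 D p)) ⟩
      p ^ (2 * s)           ≡⟨ cong (p ^_) (*-comm 2 s) ⟩
      p ^ (s * 2)           ≡⟨ sym (^-*-assoc p s 2) ⟩
      (p ^ s) ^ 2           ≤⟨ ^-monoˡ-≤ 2 (p^digitSum≤n^[2k] B 2≤n (≤-<-trans n≤B B<p^B)) ⟩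
      (n ^ (2 * k)) ^ 2     ≡⟨ ^-*-assoc n (2 * k) 2 ⟩
      n ^ (2 * k * 2)       ≡⟨ cong (n ^_) (trans (*-comm (2 * k) 2) (sym (*-assoc 2 2 k))) ⟩
      n ^ (4 * k)           ≤⟨ ^-monoʳ-≤ n (*-monoˡ-≤ k (m≤n+m 4 (2 * e))) ⟩
      n ^ ((2 * e + 4) * k) ∎
      where open ≤-Reasoning

  deviation-bound : ∀ {K} → IsExponent p ∣ prodF a b c n ∣ K → p ^ ∣ (K * k) ℤ.⊖ (n * ρ) ∣ ≤ n ^ ((2 * e + 4) * k)
  deviation-bound {K} K-exp = begin
    p ^ ∣ (K * k) ℤ.⊖ (n * ρ) ∣   ≡⟨ cong (λ x → p ^ ∣ x ∣) (K*k⊖n*ρ≡E*k⊖ρ*s {k} {n} {ρ} {K} {quotSum B n} {s} {E} (n≡k*quotSum+digitSum B n) K≡) ⟩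
    p ^ ∣ (E * k) ℤ.⊖ (ρ * s) ∣   ≤⟨ p^∣x⊖y∣≤ p {E * k} {ρ * s} p^[E*k]≤ p^[ρ*s]≤ ⟩
    n ^ ((2 * e + 4) * k)         ∎
    where
    open ≤-Reasoning
    K≡ = trans (IsExponent-unique K-exp IsExponent-α) (proj₁ (proj₂ excess))

0<i⇒1≤∣i∣ : ∀ {i} → 0ℤ ℤ.< i → 1 ≤ ∣ i ∣
0<i⇒1≤∣i∣ {ℤ.+[1+ n ]} _ = s≤s z≤n
0<i⇒1≤∣i∣ {+ zero} (ℤ.+<+ ())

mainTheorem7 : (a b c : ℤ) → ℤ.0ℤ ℤ.< a → Irreducible a b c → PosIncr a b c →
    ∃[ C ] (∀ (p : ℕ) → Prime p → ¬ (p ∣ ∣ + 2 ℤ.* a ℤ.* disc a b c ∣) →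
      ∀ (n : ℕ) → 2 ≤ n → ∀ (k : ℕ) → IsExponent p ∣ prodF a b c n ∣ k →
        p ^ ∣ + k ℤ.* (+ p ℤ.- ℤ.1ℤ) ℤ.- + n ℤ.* (ℤ.1ℤ ℤ.+ legendre (disc a b c) p) ∣
          ≤ n ^ (C * (p ∸ 1)))
mainTheorem7 a b c 0<a irr _ = 2 * (M + 2) + 4 , λ where
    zero    pp → ⊥-elim (¬prime[0] pp)
    (suc k) pp p∤2aD n 2≤n K K-exp →
      let p∤2 , p∤a , p∤D = ∤-2aD {suc k} {a} {disc a b c} p∤2aD in
      subst (λ z → suc k ^ ∣ z ∣ ≤ n ^ ((2 * (M + 2) + 4) * k)) (sym (deviation≡⊖ (disc a b c) k K n p∤D))
            (Deviation.deviation-bound a b c irr 1≤M pp p∤2 p∤a p∤D 2≤n {K} K-exp)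
  where
  M = ∣ a ∣ + ∣ b ∣ + ∣ c ∣
  1≤M : 1 ≤ M
  1≤M = ≤-trans (0<i⇒1≤∣i∣ 0<a) (≤-trans (m≤m+n ∣ a ∣ ∣ b ∣) (m≤m+n (∣ a ∣ + ∣ b ∣) ∣ c ∣))
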